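{- Let $\eta=(\eta_1,\dots,\eta_r)$ be a composition of $n$ and let $\sigma\in S^\eta$. Then $$|N^+_\sigma[\succ]|=\operatorname{imv}\big(E(\pi_\eta(\sigma^{ -1}))\big)+|N^-_\sigma|+\operatorname{iexc}(\sigma).$$
   Context: Write $[n]=\{1,\dots,n\}$. The block map $\pi_\eta:[n]\to[r]$ sends $i$ to the unique $k$ with $\sum_{l<k}\eta_l<i\le\sum_{l\le k}\eta_l$. For $\tau\in S_n$, $\pi_\eta(\tau)$ denotes the word $\pi_\eta(\tau(1))\cdots\pi_\eta(\tau(n))$, a rearrangement of $\mathrm{id}=1^{\eta_1}\cdots r^{\eta_r}$. A permutation $\sigma\in S_n$ is $\eta$-admissible if $\sigma(i)<\sigma(j)$ whenever $i<j$ and $\pi_\eta(i)=\pi_\eta(j)$; $S^\eta$ is the set of such permutations. For a word $w=w_1\cdots w_n$ that is a rearrangement of $\mathrm{id}$: $\operatorname{Exc}(w)=\{i:w_i>\mathrm{id}_i\}$, and the exceeding subword $E(w)$ is the subword of $w$ formed by the letters in positions of $\operatorname{Exc}(w)$, taken in increasing order of position. For a word $u=u_1\cdots u_m$, $\operatorname{imv}(u)=|\{(i,j):i<j,\ u_i\ge u_j\}|$. For $\sigma\in S_n$: - $N^+_\sigma[\succ]=\{(i,j)\in[n]^2:\sigma(i)<j,\ \sigma^{ -1}(j)<i,\ \pi_\eta(i)\le\pi_\eta(j),\ \pi_\eta(i)>\pi_\eta(\sigma(i))\}$; - $N^-_\sigma=\{(i,j)\in[n]^2:\pi_\eta(i)>\pi_\eta(j),\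 \sigma(i)<j,\ \sigma^{ -1}(j)>i\}$; - $\operatorname{iexc}(\sigma)=|\{j\in[n]:\pi_\eta(\sigma^{ -1}(j))>\pi_\eta(j)\}|$. -}

module Defs where

open import Data.Nat using (ℕ; zero; suc; _∸_; _+_; _<_; _≤_; _<?_; _≤?_)
open import Data.Bool using (Bool; true; false; if_then_else_; _∧_)
open import Data.List using (List; []; _∷_; length; filter; map)
open import Data.Nat.ListAction using (sum)
open import Data.Fin using (Fin; toℕ)
open import Data.Fin.Permutation using (Permutation′; _⟨$⟩ʳ_; _⟨$⟩ˡ_)
open import Data.List.Relation.Unary.All using (All)
open import Data.Vec.Functional using () 
open import Data.List using (allFin) public
open import Relation.Nullary.Decidable using (⌊_⌋)
import Relation.Nullary
import Data.Bool
open import Relation.Binary.PropositionalEquality using (_≡_)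

IsComposition : List ℕ → Set
IsComposition η = All (λ k → 1 ≤ k) η

-- 0-based block index of a 0-based position i (block map π_η shifted by one;
-- only the order of block indices matters, and all uses are consistent).
blockOf : List ℕ → ℕ → ℕ
blockOf []       i = 0
blockOf (e ∷ es) i = if ⌊ i <? e ⌋ then 0 else suc (blockOf es (i ∸ e))

π : (η : List ℕ) → Fin (sum η) → ℕ
π η i = blockOf η (toℕ i)

Perm : ℕ → Set
Perm n = Permutation′ n

Admissible : (η : List ℕ) → Perm (sum η) → Set
Admissible η σ = ∀ i j → toℕ i < toℕ j → π η i ≡ π η j →
                 toℕ (σ ⟨$⟩ʳ i) < toℕ (σ ⟨$⟩ʳ j)

count : ∀ {n} → (Fin n → Bool) → ℕ
count {n} p = length (filter (λ i → p i Data.Bool.≟ true) (allFin n))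

count₂ : ∀ {n} → (Fin n → Fin n → Bool) → ℕ
count₂ {n} p = sum (map (λ i → count (p i)) (allFin n))

imv : List ℕ → ℕ
imv []       = 0
imv (x ∷ xs) = length (filter (λ y → y ≤? x) xs) + imv xs

module _ (η : List ℕ) (σ : Perm (sum η)) where
  private
    n = sum η
    σ→ : Fin n → ℕ
    σ→ i = toℕ (σ ⟨$⟩ʳ i)
    σ⁻¹ : Fin n → Fin n
    σ⁻¹ j = σ ⟨$⟩ˡ j
    b : ∀ {P : Set} → Relation.Nullary.Dec P → Bool
    b d = ⌊ d ⌋

  wordInv : Fin n → ℕ
  wordInv j = π η (σ⁻¹ j)

  exceedingSubword : List ℕ
  exceedingSubword = map wordInv (filter (λ j → π η j <? wordInv j) (allFin n))

  NplusCard : ℕ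
  NplusCard = count₂ λ i j →
    b (σ→ i <? toℕ j) ∧ b (toℕ (σ⁻¹ j) <? toℕ i) ∧
    b (π η i ≤? π η j) ∧ b (π η (σ ⟨$⟩ʳ i) <? π η i)

  NminusCard : ℕ
  NminusCard = count₂ λ i j →
    b (π η j <? π η i) ∧ b (σ→ i <? toℕ j) ∧ b (toℕ i <? toℕ (σ⁻¹ j))

  iexc : ℕ
  iexc = count λ j → b (π η j <? π η (σ⁻¹ j))

-- Substituting i = σ⁻¹(a) groups the pairs of N⁺ and N⁻ into rows indexed by the positions
-- a of the word w = π_η(σ⁻¹).  A row is empty unless a is an excedance, π_η(a) < w_a.
-- Admissibility (σ increasing on each block) gives, for a < j, that σ⁻¹(j) < σ⁻¹(a) iff
-- w_j < w_a.  With this, the cases j < a, j = a, j > a show, for an excedance a and every j,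
--   [π_η(j) < w_a] + [(σ⁻¹a, j) ∈ N⁺]
--     = [j < a, j excedance, w_a ≤ w_j] + [(σ⁻¹a, j) ∈ N⁻] + [j = a] + [w_j < w_a],
-- and summed over j the outer terms cancel, since w = π_η ∘ σ⁻¹ is a rearrangement of π_η.
-- Summing the rows over a, the pairs j < a are the pairs counted by imv of the exceeding
-- subword and the terms [j = a] add up to iexc.

module Submission where

open import Defs
open import Data.Nat using (ℕ; _+_)
open import Data.List using (List)
open import Data.Nat.ListAction using (sum)
open import Relation.Binary.PropositionalEquality using (_≡_)

open import Data.Bool using (Bool; true; false; _∧_; not)
open import Data.Bool.Properties using (∧-zeroʳ) renaming (_≟_ to _≟ᵇ_)
open import Data.Fin using (Fin; toℕ) renaming (zero to fzero; suc to fsuc)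
open import Data.Fin.Permutation using (_⟨$⟩ʳ_; _⟨$⟩ˡ_; flip; inverseʳ)
open import Data.Fin.Properties using (_≟_; toℕ-injective; suc-injective)
open import Data.List using ([]; _∷_; length; filter; map; tabulate)
open import Data.List.Properties using (map-tabulate; filter-accept; filter-reject)
open import Data.Nat using (zero; suc; _<_; _≤_; _<?_; _≤?_; z≤n; s≤s)
open import Data.Nat.Properties
  using ( +-0-commutativeMonoid; +-cancelʳ-≡; ≤-pred; <⇒≤; <⇒≱; ≰⇒>; ≮⇒≥; ≤∧≢⇒<
        ; ≤-<-trans; <-≤-trans; <-asym; <-irrefl; <-cmp; ∸-monoˡ-≤)
open import Data.Sum using ([_,_]′)
open import Function using (_∘_; id)
open import Relation.Binary using (tri<; tri≈; tri>)
open import Relation.Binary.PropositionalEquality using (refl; sym; trans; cong; cong₂; subst₂; module ≡-Reasoning)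
open import Relation.Nullary using (¬_; Dec; yes; no; contradiction)
open import Relation.Nullary.Decidable using (⌊_⌋; toSum)
open import Relation.Unary using (Decidable)
import Algebra.Properties.CommutativeMonoid.Sum as CommutativeMonoidSum

open CommutativeMonoidSum +-0-commutativeMonoid
  using (sum-cong-≗; sum-replicate-zero; ∑-distrib-+; ∑-comm; sum-permute)
  renaming (sum to ∑)

𝟙 : Bool → ℕ
𝟙 true  = 1
𝟙 false = 0

⌊⌋-true : ∀ {A : Set} (a? : Dec A) → A → ⌊ a? ⌋ ≡ true
⌊⌋-true (yes _) _ = refl
⌊⌋-true (no ¬a) a = contradiction a ¬a

⌊⌋-false : ∀ {A : Set} (a? : Dec A) → ¬ A → ⌊ a? ⌋ ≡ false
⌊⌋-false (yes a) ¬a = contradiction a ¬a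
⌊⌋-false (no _)  _  = refl

⌊⌋-⇔ : ∀ {A B : Set} (a? : Dec A) (b? : Dec B) → (A → B) → (B → A) → ⌊ a? ⌋ ≡ ⌊ b? ⌋
⌊⌋-⇔ (yes a) (yes b) f g = refl
⌊⌋-⇔ (yes a) (no ¬b) f g = contradiction (f a) ¬b
⌊⌋-⇔ (no ¬a) (yes b) f g = contradiction (g b) ¬a
⌊⌋-⇔ (no ¬a) (no ¬b) f g = refl

⌊≤?⌋≡not⌊<?⌋ : ∀ x y → ⌊ x ≤? y ⌋ ≡ not ⌊ y <? x ⌋
⌊≤?⌋≡not⌊<?⌋ x y with y <? x
... | yes y<x = ⌊⌋-false (x ≤? y) (<⇒≱ y<x)
... | no  y≮x = ⌊⌋-true (x ≤? y) (≮⇒≥ y≮x)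

⌊suc<?suc⌋ : ∀ x y → ⌊ suc x <? suc y ⌋ ≡ ⌊ x <? y ⌋
⌊suc<?suc⌋ x y = ⌊⌋-⇔ (suc x <? suc y) (x <? y) ≤-pred s≤s

∧³-zeroʳ : ∀ p q r → p ∧ q ∧ r ∧ false ≡ false
∧³-zeroʳ p q r rewrite ∧-zeroʳ r | ∧-zeroʳ q | ∧-zeroʳ p = refl

∑-zero : ∀ {m} {f : Fin m → ℕ} → (∀ i → f i ≡ 0) → ∑ f ≡ 0
∑-zero {m} f≗0 = trans (sum-cong-≗ f≗0) (sum-replicate-zero m)

∑-distrib-+₃ : ∀ {m} (f g h : Fin m → ℕ) → ∑ (λ i → f i + g i + h i) ≡ ∑ f + ∑ g + ∑ h
∑-distrib-+₃ f g h = trans (∑-distrib-+ (λ i → f i + g i) h) (cong (_+ ∑ h) (∑-distrib-+ f g))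

∑-distrib-+₄ : ∀ {m} (f g h k : Fin m → ℕ) → ∑ (λ i → f i + g i + h i + k i) ≡ ∑ f + ∑ g + ∑ h + ∑ k
∑-distrib-+₄ f g h k = trans (∑-distrib-+ (λ i → f i + g i + h i) k) (cong (_+ ∑ k) (∑-distrib-+₃ f g h))

∑-𝟙-≟ : ∀ {m} (a : Fin m) → ∑ (λ j → 𝟙 ⌊ j ≟ a ⌋) ≡ 1
∑-𝟙-≟ {suc m} fzero    = cong suc (∑-zero {m} (λ _ → refl))
∑-𝟙-≟ {suc m} (fsuc a) = trans (sum-cong-≗ {m} ⌊fsuc≟fsuc⌋) (∑-𝟙-≟ a)
  where
  ⌊fsuc≟fsuc⌋ : ∀ j → 𝟙 ⌊ fsuc j ≟ fsuc a ⌋ ≡ 𝟙 ⌊ j ≟ a ⌋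
  ⌊fsuc≟fsuc⌋ j = cong 𝟙 (⌊⌋-⇔ (fsuc j ≟ fsuc a) (j ≟ a) suc-injective (cong fsuc))

sum-tabulate : ∀ {m} (f : Fin m → ℕ) → sum (tabulate f) ≡ ∑ f
sum-tabulate {zero}  f = refl
sum-tabulate {suc m} f = cong (f fzero +_) (sum-tabulate (f ∘ fsuc))

length-filter-≟true : ∀ {A : Set} (p : A → Bool) xs →
  length (filter (λ x → p x ≟ᵇ true) xs) ≡ sum (map (𝟙 ∘ p) xs)
length-filter-≟true p []       = refl
length-filter-≟true p (x ∷ xs) with p x
... | true  = cong suc (length-filter-≟true p xs)
... | false = length-filter-≟true p xs

count≡∑ : ∀ {m} (p : Fin m → Bool) → count p ≡ ∑ (𝟙 ∘ p)
count≡∑ p = trans (length-filter-≟true p (tabulate id))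
                  (trans (cong sum (map-tabulate id (𝟙 ∘ p))) (sum-tabulate (𝟙 ∘ p)))

count₂≡∑∑ : ∀ {m} (p : Fin m → Fin m → Bool) → count₂ p ≡ ∑ (λ i → ∑ (𝟙 ∘ p i))
count₂≡∑∑ {m} p = trans (cong sum (map-tabulate id (count ∘ p)))
                        (trans (sum-tabulate (count ∘ p)) (sum-cong-≗ {m} (count≡∑ ∘ p)))

module _ {A : Set} (w : A → ℕ) {Q : A → Set} (Q? : Decidable Q) where

  #≤-map-filter : ∀ x xs → length (filter (_≤? x) (map w (filter Q? xs)))
                  ≡ sum (map (λ a → 𝟙 (⌊ w a ≤? x ⌋ ∧ ⌊ Q? a ⌋)) xs)
  #≤-map-filter x []       = refl
  #≤-map-filter x (y ∷ ys) with Q? y | w y ≤? x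
  ... | no  _ | yes _    = #≤-map-filter x ys
  ... | no  _ | no  _    = #≤-map-filter x ys
  ... | yes _ | yes wy≤x = trans (cong length (filter-accept (_≤? x) wy≤x)) (cong suc (#≤-map-filter x ys))
  ... | yes _ | no  wy≰x = trans (cong length (filter-reject (_≤? x) wy≰x)) (#≤-map-filter x ys)

  #≤-map-filter-tabulate : ∀ {m} x (g : Fin m → A) →
    length (filter (_≤? x) (map w (filter Q? (tabulate g))))
    ≡ ∑ (λ a → 𝟙 (⌊ w (g a) ≤? x ⌋ ∧ ⌊ Q? (g a) ⌋))
  #≤-map-filter-tabulate x g = begin
    length (filter (_≤? x) (map w (filter Q? (tabulate g))))
      ≡⟨ #≤-map-filter x (tabulate g) ⟩
    sum (map (λ a → 𝟙 (⌊ w a ≤? x ⌋ ∧ ⌊ Q? a ⌋)) (tabulate g))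
      ≡⟨ cong sum (map-tabulate g (λ a → 𝟙 (⌊ w a ≤? x ⌋ ∧ ⌊ Q? a ⌋))) ⟩
    sum (tabulate (λ a → 𝟙 (⌊ w (g a) ≤? x ⌋ ∧ ⌊ Q? (g a) ⌋)))
      ≡⟨ sum-tabulate (λ a → 𝟙 (⌊ w (g a) ≤? x ⌋ ∧ ⌊ Q? (g a) ⌋)) ⟩
    ∑ (λ a → 𝟙 (⌊ w (g a) ≤? x ⌋ ∧ ⌊ Q? (g a) ⌋)) ∎
    where open ≡-Reasoning

  -- Conjuncts ordered so that the row and column of index zero reduce by computation.
  imv-pair : ∀ {m} → (Fin m → A) → Fin m → Fin m → ℕ
  imv-pair g j a = 𝟙 (⌊ toℕ j <? toℕ a ⌋ ∧ ⌊ Q? (g j) ⌋ ∧ ⌊ w (g a) ≤? w (g j) ⌋ ∧ ⌊ Q? (g a) ⌋)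

  imv-pair-suc : ∀ {m} (g : Fin (suc m) → A) j → ∑ (imv-pair g (fsuc j)) ≡ ∑ (imv-pair (g ∘ fsuc) j)
  imv-pair-suc {m} g j = sum-cong-≗ {m} λ a →
    cong (λ b → 𝟙 (b ∧ ⌊ Q? (g (fsuc j)) ⌋ ∧ ⌊ w (g (fsuc a)) ≤? w (g (fsuc j)) ⌋ ∧ ⌊ Q? (g (fsuc a)) ⌋))
         (⌊suc<?suc⌋ (toℕ j) (toℕ a))

  imv-map-filter-tabulate : ∀ {m} (g : Fin m → A) →
    imv (map w (filter Q? (tabulate g))) ≡ ∑ (λ j → ∑ (imv-pair g j))
  imv-map-filter-tabulate-tail : ∀ {m} (g : Fin (suc m) → A) →
    imv (map w (filter Q? (tabulate (g ∘ fsuc)))) ≡ ∑ (λ j → ∑ (imv-pair g (fsuc j)))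

  imv-map-filter-tabulate {zero}  g = refl
  imv-map-filter-tabulate {suc m} g with Q? (g fzero)
  ... | yes _ = cong₂ _+_ (#≤-map-filter-tabulate (w (g fzero)) (g ∘ fsuc)) (imv-map-filter-tabulate-tail g)
  ... | no  _ = cong₂ _+_ (sym (∑-zero {m} (λ _ → refl))) (imv-map-filter-tabulate-tail g)

  imv-map-filter-tabulate-tail {m} g =
    trans (imv-map-filter-tabulate (g ∘ fsuc)) (sum-cong-≗ {m} (λ j → sym (imv-pair-suc g j)))

blockOf-mono : ∀ η {i k} → i ≤ k → blockOf η i ≤ blockOf η k
blockOf-mono []       _   = z≤n
blockOf-mono (e ∷ es) {i} {k} i≤k with i <? e | k <? e
... | yes _   | _       = z≤n
... | no  i≮e | yes k<e = contradiction (≤-<-trans i≤k k<e) i≮e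
... | no  _   | no  _   = s≤s (blockOf-mono es (∸-monoˡ-≤ e i≤k))

π-mono : ∀ η {i k : Fin (sum η)} → toℕ i ≤ toℕ k → π η i ≤ π η k
π-mono η = blockOf-mono η

π-reflects-< : ∀ η {i k : Fin (sum η)} → π η i < π η k → toℕ i < toℕ k
π-reflects-< η πi<πk = ≰⇒> (λ k≤i → <⇒≱ πi<πk (π-mono η k≤i))

module _ (η : List ℕ) (σ : Perm (sum η)) where
  private
    n : ℕ
    n = sum η

    σ⁻¹ : Fin n → Fin n
    σ⁻¹ j = σ ⟨$⟩ˡ j

    w : Fin n → ℕ
    w = wordInv η σ

  N⁺ : Fin n → Fin n → Bool
  N⁺ i j = ⌊ toℕ (σ ⟨$⟩ʳ i) <? toℕ j ⌋ ∧ ⌊ toℕ (σ⁻¹ j) <? toℕ i ⌋ ∧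
           ⌊ π η i ≤? π η j ⌋ ∧ ⌊ π η (σ ⟨$⟩ʳ i) <? π η i ⌋

  N⁻ : Fin n → Fin n → Bool
  N⁻ i j = ⌊ π η j <? π η i ⌋ ∧ ⌊ toℕ (σ ⟨$⟩ʳ i) <? toℕ j ⌋ ∧ ⌊ toℕ i <? toℕ (σ⁻¹ j) ⌋

  exc? : (j : Fin n) → Dec (π η j < w j)
  exc? j = π η j <? w j

  inv-pair : Fin n → Fin n → ℕ
  inv-pair = imv-pair w exc? id

  ∑-∘σ⁻¹ : (f : Fin n → ℕ) → ∑ f ≡ ∑ (f ∘ σ⁻¹)
  ∑-∘σ⁻¹ f = sum-permute f (flip σ)

  σ⁻¹-injective : ∀ {a j} → σ⁻¹ a ≡ σ⁻¹ j → a ≡ j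
  σ⁻¹-injective eq = trans (sym (inverseʳ σ)) (trans (cong (σ ⟨$⟩ʳ_) eq) (inverseʳ σ))

  NplusCard≡∑-rows : NplusCard η σ ≡ ∑ (λ a → ∑ (𝟙 ∘ N⁺ (σ⁻¹ a)))
  NplusCard≡∑-rows = trans (count₂≡∑∑ N⁺) (∑-∘σ⁻¹ (λ i → ∑ (𝟙 ∘ N⁺ i)))

  NminusCard≡∑-rows : NminusCard η σ ≡ ∑ (λ a → ∑ (𝟙 ∘ N⁻ (σ⁻¹ a)))
  NminusCard≡∑-rows = trans (count₂≡∑∑ N⁻) (∑-∘σ⁻¹ (λ i → ∑ (𝟙 ∘ N⁻ i)))

  iexc≡∑ : iexc η σ ≡ ∑ (λ a → 𝟙 ⌊ exc? a ⌋)
  iexc≡∑ = count≡∑ (λ a → ⌊ exc? a ⌋)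

  imv≡∑-rows : imv (exceedingSubword η σ) ≡ ∑ (λ a → ∑ (λ j → inv-pair j a))
  imv≡∑-rows = trans (imv-map-filter-tabulate w exc? id) (∑-comm inv-pair)

  module _ (admissible : Admissible η σ) where

    descent-σ⁻¹⇒descent-w : ∀ {a j} → toℕ a < toℕ j → toℕ (σ⁻¹ j) < toℕ (σ⁻¹ a) → w j < w a
    descent-σ⁻¹⇒descent-w a<j σ⁻¹j<σ⁻¹a = ≤∧≢⇒< (π-mono η (<⇒≤ σ⁻¹j<σ⁻¹a)) λ same-block →
      <-asym a<j (subst₂ (λ u v → toℕ u < toℕ v) (inverseʳ σ) (inverseʳ σ)
                         (admissible (σ⁻¹ _) (σ⁻¹ _) σ⁻¹j<σ⁻¹a same-block))

    ⌊σ⁻¹-descent⌋ : ∀ {a j} → toℕ a < toℕ j → ⌊ toℕ (σ⁻¹ j) <? toℕ (σ⁻¹ a) ⌋ ≡ ⌊ w j <? w a ⌋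
    ⌊σ⁻¹-descent⌋ {a} {j} a<j =
      ⌊⌋-⇔ (toℕ (σ⁻¹ j) <? toℕ (σ⁻¹ a)) (w j <? w a) (descent-σ⁻¹⇒descent-w a<j) (π-reflects-< η)

    ⌊σ⁻¹-ascent⌋ : ∀ {a j} → toℕ a < toℕ j → ⌊ toℕ (σ⁻¹ a) <? toℕ (σ⁻¹ j) ⌋ ≡ not ⌊ w j <? w a ⌋
    ⌊σ⁻¹-ascent⌋ {a} {j} a<j =
      trans (⌊⌋-⇔ (toℕ (σ⁻¹ a) <? toℕ (σ⁻¹ j)) (w a ≤? w j) (π-mono η ∘ <⇒≤) ascent)
            (⌊≤?⌋≡not⌊<?⌋ (w a) (w j))
      where
      ascent : w a ≤ w j → toℕ (σ⁻¹ a) < toℕ (σ⁻¹ j)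
      ascent wa≤wj with <-cmp (toℕ (σ⁻¹ a)) (toℕ (σ⁻¹ j))
      ... | tri< σ⁻¹a<σ⁻¹j _ _ = σ⁻¹a<σ⁻¹j
      ... | tri≈ _ same _       =
        contradiction (cong toℕ (σ⁻¹-injective (toℕ-injective same))) (λ a≡j → <-irrefl a≡j a<j)
      ... | tri> _ _ σ⁻¹j<σ⁻¹a = contradiction wa≤wj (<⇒≱ (descent-σ⁻¹⇒descent-w a<j σ⁻¹j<σ⁻¹a))

    RowIdentity : Fin n → Fin n → Set
    RowIdentity a j =
      𝟙 (N⁺ (σ⁻¹ a) j) + 𝟙 ⌊ π η j <? w a ⌋
      ≡ inv-pair j a + 𝟙 (N⁻ (σ⁻¹ a) j) + 𝟙 ⌊ j ≟ a ⌋ + 𝟙 ⌊ w j <? w a ⌋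

    row-identity-< : ∀ {a j} → π η a < w a → toℕ j < toℕ a → RowIdentity a j
    row-identity-< {a} {j} exc-a j<a
      rewrite inverseʳ σ {a}
            | ⌊⌋-false (toℕ a <? toℕ j) (<-asym j<a)
            | ⌊⌋-true (π η j <? w a) (≤-<-trans (π-mono η (<⇒≤ j<a)) exc-a)
            | ⌊⌋-false (j ≟ a) (λ j≡a → <-irrefl (cong toℕ j≡a) j<a)
            | ⌊⌋-true (toℕ j <? toℕ a) j<a
            | ⌊⌋-true (exc? a) exc-a
            | ⌊≤?⌋≡not⌊<?⌋ (w a) (w j)
      with exc? j | w j <? w a
    ... | yes _     | yes _    = refl
    ... | no  _     | yes _    = refl
    ... | yes _     | no  _    = refl
    ... | no ¬exc-j | no wj≮wa =
      contradiction (≤-<-trans (π-mono η (<⇒≤ j<a)) (<-≤-trans exc-a (≮⇒≥ wj≮wa))) ¬exc-j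

    row-identity-≡ : ∀ {a} → π η a < w a → RowIdentity a a
    row-identity-≡ {a} exc-a
      rewrite inverseʳ σ {a}
            | ⌊⌋-false (toℕ a <? toℕ a) (<-irrefl refl)
            | ⌊⌋-true (exc? a) exc-a
            | ⌊⌋-true (a ≟ a) refl
            | ⌊⌋-false (w a <? w a) (<-irrefl refl)
      = refl

    row-identity-> : ∀ {a j} → π η a < w a → toℕ a < toℕ j → RowIdentity a j
    row-identity-> {a} {j} exc-a a<j
      rewrite inverseʳ σ {a}
            | ⌊⌋-true (toℕ a <? toℕ j) a<j
            | ⌊⌋-false (toℕ j <? toℕ a) (<-asym a<j)
            | ⌊⌋-false (j ≟ a) (λ j≡a → <-irrefl (cong toℕ (sym j≡a)) a<j)
            | ⌊⌋-true (exc? a) exc-a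
            | ⌊σ⁻¹-descent⌋ a<j
            | ⌊σ⁻¹-ascent⌋ a<j
            | ⌊≤?⌋≡not⌊<?⌋ (w a) (π η j)
      with ⌊ π η j <? w a ⌋ | ⌊ w j <? w a ⌋
    ... | true  | true  = refl
    ... | true  | false = refl
    ... | false | true  = refl
    ... | false | false = refl

    row-identity : ∀ {a} → π η a < w a → ∀ j → RowIdentity a j
    row-identity {a} exc-a j with <-cmp (toℕ j) (toℕ a)
    ... | tri< j<a _ _ = row-identity-< exc-a j<a
    ... | tri≈ _ j≡a _ rewrite toℕ-injective j≡a = row-identity-≡ exc-a
    ... | tri> _ _ a<j = row-identity-> exc-a a<j

    N⁺-row-vanishes : ∀ {a} → ¬ π η a < w a → ∀ j → 𝟙 (N⁺ (σ⁻¹ a) j) ≡ 0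
    N⁺-row-vanishes {a} ¬exc-a j rewrite inverseʳ σ {a} | ⌊⌋-false (exc? a) ¬exc-a =
      cong 𝟙 (∧³-zeroʳ ⌊ toℕ a <? toℕ j ⌋ ⌊ toℕ (σ⁻¹ j) <? toℕ (σ⁻¹ a) ⌋ ⌊ w a ≤? π η j ⌋)

    N⁻-row-vanishes : ∀ {a} → ¬ π η a < w a → ∀ j → 𝟙 (N⁻ (σ⁻¹ a) j) ≡ 0
    N⁻-row-vanishes {a} ¬exc-a j rewrite inverseʳ σ {a} with π η j <? w a
    ... | no  _     = refl
    ... | yes πj<wa
      rewrite ⌊⌋-false (toℕ a <? toℕ j) (λ a<j → ¬exc-a (≤-<-trans (π-mono η (<⇒≤ a<j)) πj<wa))
      = refl

    inv-pair-vanishes : ∀ {a} → ¬ π η a < w a → ∀ j → inv-pair j a ≡ 0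
    inv-pair-vanishes {a} ¬exc-a j rewrite ⌊⌋-false (exc? a) ¬exc-a =
      cong 𝟙 (∧³-zeroʳ ⌊ toℕ j <? toℕ a ⌋ ⌊ exc? j ⌋ ⌊ w a ≤? w j ⌋)

    RowSum : Fin n → Set
    RowSum a = ∑ (𝟙 ∘ N⁺ (σ⁻¹ a)) ≡ ∑ (λ j → inv-pair j a) + ∑ (𝟙 ∘ N⁻ (σ⁻¹ a)) + 𝟙 ⌊ exc? a ⌋

    row-sum-exc : ∀ a → π η a < w a → RowSum a
    row-sum-exc a exc-a = +-cancelʳ-≡ (∑ below) _ _ (begin
        ∑ (𝟙 ∘ N⁺ (σ⁻¹ a)) + ∑ below
      ≡⟨ sym (∑-distrib-+ (𝟙 ∘ N⁺ (σ⁻¹ a)) below) ⟩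
        ∑ (λ j → 𝟙 (N⁺ (σ⁻¹ a) j) + below j)
      ≡⟨ sum-cong-≗ (row-identity exc-a) ⟩
        ∑ (λ j → inv-pair j a + 𝟙 (N⁻ (σ⁻¹ a) j) + 𝟙 ⌊ j ≟ a ⌋ + below (σ⁻¹ j))
      ≡⟨ ∑-distrib-+₄ (λ j → inv-pair j a) (𝟙 ∘ N⁻ (σ⁻¹ a)) (λ j → 𝟙 ⌊ j ≟ a ⌋) (below ∘ σ⁻¹) ⟩
        ∑ (λ j → inv-pair j a) + ∑ (𝟙 ∘ N⁻ (σ⁻¹ a)) + ∑ (λ j → 𝟙 ⌊ j ≟ a ⌋) + ∑ (below ∘ σ⁻¹)
      ≡⟨ cong₂ (λ one b → ∑ (λ j → inv-pair j a) + ∑ (𝟙 ∘ N⁻ (σ⁻¹ a)) + one + b)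
               (trans (∑-𝟙-≟ a) (sym (cong 𝟙 (⌊⌋-true (exc? a) exc-a))))
               (sym (∑-∘σ⁻¹ below)) ⟩
        ∑ (λ j → inv-pair j a) + ∑ (𝟙 ∘ N⁻ (σ⁻¹ a)) + 𝟙 ⌊ exc? a ⌋ + ∑ below ∎)
      where
      open ≡-Reasoning
      below : Fin n → ℕ
      below j = 𝟙 ⌊ π η j <? w a ⌋

    row-sum-non-exc : ∀ a → ¬ π η a < w a → RowSum a
    row-sum-non-exc a ¬exc-a = trans (∑-zero (N⁺-row-vanishes ¬exc-a))
      (sym (cong₂ _+_ (cong₂ _+_ (∑-zero (inv-pair-vanishes ¬exc-a)) (∑-zero (N⁻-row-vanishes ¬exc-a)))
                      (cong 𝟙 (⌊⌋-false (exc? a) ¬exc-a))))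

    row-sum : ∀ a → RowSum a
    row-sum a = [ row-sum-exc a , row-sum-non-exc a ]′ (toSum (exc? a))

lemma4p3 : (η : List ℕ) → IsComposition η → (σ : Perm (sum η)) → Admissible η σ →
           NplusCard η σ ≡ imv (exceedingSubword η σ) + NminusCard η σ + iexc η σ
-- The identity holds for every list η.
lemma4p3 η _ σ admissible = begin
    NplusCard η σ
  ≡⟨ NplusCard≡∑-rows η σ ⟩
    ∑ (λ a → ∑ (𝟙 ∘ N⁺ η σ (σ ⟨$⟩ˡ a)))
  ≡⟨ sum-cong-≗ (row-sum η σ admissible) ⟩
    ∑ (λ a → ∑ (λ j → inv-pair η σ j a) + ∑ (𝟙 ∘ N⁻ η σ (σ ⟨$⟩ˡ a)) + 𝟙 ⌊ exc? η σ a ⌋)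
  ≡⟨ ∑-distrib-+₃ (λ a → ∑ (λ j → inv-pair η σ j a)) (λ a → ∑ (𝟙 ∘ N⁻ η σ (σ ⟨$⟩ˡ a))) (λ a → 𝟙 ⌊ exc? η σ a ⌋) ⟩
    ∑ (λ a → ∑ (λ j → inv-pair η σ j a)) + ∑ (λ a → ∑ (𝟙 ∘ N⁻ η σ (σ ⟨$⟩ˡ a))) + ∑ (λ a → 𝟙 ⌊ exc? η σ a ⌋)
  ≡⟨ sym (cong₂ _+_ (cong₂ _+_ (imv≡∑-rows η σ) (NminusCard≡∑-rows η σ)) (iexc≡∑ η σ)) ⟩
    imv (exceedingSubword η σ) + NminusCard η σ + iexc η σ
  ∎
  where open ≡-Reasoning
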